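{- A permutation $\sigma\in S_n$ is a skew permutation if and only if for all $i\in[n]$, $\sigma(i)=\min\{\sigma(i),\sigma(i+1),\dots,\sigma(n)\}$ or $\sigma(i)=\max\{\sigma(i),\sigma(i+1),\dots,\sigma(n)\}$.
   Context: A full binary tree is a rooted ordered tree in which every node is either a leaf or an internal node with exactly two children; a full skew tree is a full binary tree in which every internal node has at least one leaf child. Given a full binary tree with $n$ internal nodes, its in-order labeling labels the internal nodes by $1,\dots,n$ so that the in-order traversal of the internal nodes is $1,\dots,n$; the associated permutation $\sigma$ lists the labels of the internal nodes in pre-order traversal (root, left subtree, right subtree). A skew permutation is the permutation associated with some full skew tree with $n$ internal nodes. -}

module Defs where

open import Data.Nat using (ℕ; zero; suc; _+_; _≤_)
open import Data.List using (List; []; _∷_; _++_; length; lookup; drop; map; upTo)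
open import Data.List.Relation.Unary.All using (All)
open import Data.List.Relation.Binary.Permutation.Propositional using (_↭_)
open import Data.Fin using (Fin; toℕ)
open import Data.Product using (Σ; _×_)
open import Data.Sum using (_⊎_)
open import Data.Unit using (⊤)
open import Data.Empty using (⊥)
open import Relation.Binary.PropositionalEquality using (_≡_)

data FBT : Set where
  leaf : FBT
  node : FBT → FBT → FBT

internal : FBT → ℕ
internal leaf = 0
internal (node l r) = suc (internal l + internal r)

IsLeaf : FBT → Set
IsLeaf leaf = ⊤
IsLeaf (node _ _) = ⊥

Skew : FBT → Set
Skew leaf = ⊤
Skew (node l r) = (IsLeaf l ⊎ IsLeaf r) × Skew l × Skew r

-- Pre-order list of the in-order labels of the internal nodes, where the
-- internal nodes of the tree receive in-order labels off+1, off+2, ...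
-- (root, then left subtree, then right subtree).
preorderLabels : ℕ → FBT → List ℕ
preorderLabels off leaf = []
preorderLabels off (node l r) =
  (off + internal l + 1) ∷ (preorderLabels off l ++ preorderLabels (off + internal l + 1) r)

assocPerm : FBT → List ℕ
assocPerm t = preorderLabels 0 t

[_] : ℕ → List ℕ
[ n ] = map suc (upTo n)

-- σ ∈ S_n, in one-line notation σ(1) σ(2) ... σ(n)
IsPermOf : ℕ → List ℕ → Set
IsPermOf n σ = σ ↭ [ n ]

IsSkewPerm : ℕ → List ℕ → Set
IsSkewPerm n σ = Σ FBT (λ t → Skew t × internal t ≡ n × assocPerm t ≡ σ)

MinOrMaxSuffix : List ℕ → Set
MinOrMaxSuffix σ = (i : Fin (length σ)) →
  All (λ x → lookup σ i ≤ x) (drop (suc (toℕ i)) σ)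
  ⊎ All (λ x → x ≤ lookup σ i) (drop (suc (toℕ i)) σ)

-- A skew tree is a leaf, or a root whose left or right child is a leaf. In pre-order the
-- root comes first and the labels of the non-leaf subtree form an interval just above it
-- (leaf on the left) or just below it (leaf on the right), so σ(1) is the minimum or the
-- maximum of σ, and recursively for every suffix. Conversely, if σ is a permutation of an
-- interval whose first entry is its minimum (maximum), that entry is the lower (upper)
-- end of the interval, and the rest of σ is again a permutation of an interval; recursing
-- builds the skew tree with the leaf on the left (right).
module Submission where

open import Defs
open import Data.Nat using (ℕ; zero; suc; _+_; _≤_; _<_; s≤s)
open import Data.Nat.Properties
open import Data.Nat.Solver using (module +-*-Solver)
open import Data.List using (List; []; _∷_; _∷ʳ_; applyUpTo)
open import Data.List.Properties using (++-identityʳ; map-upTo)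
open import Data.List.Relation.Unary.All as All using (All; []; _∷_)
open import Data.List.Relation.Unary.All.Properties using (++⁺)
open import Data.List.Relation.Unary.Any using (here; there)
open import Data.List.Membership.Propositional using (_∈_)
open import Data.List.Relation.Binary.Permutation.Propositional
  using (_↭_; ↭-sym; ↭-trans; ↭-reflexive)
open import Data.List.Relation.Binary.Permutation.Propositional.Properties
  using (↭-empty-inv; ¬x∷xs↭[]; ∈-resp-↭; drop-∷; ∷↭∷ʳ)
open import Data.Fin using () renaming (zero to fzero; suc to fsuc)
open import Data.Product using (Σ; _×_; _,_)
open import Data.Sum using (_⊎_; inj₁; inj₂)
open import Data.Unit using (tt)
open import Relation.Binary.PropositionalEquality
  using (_≡_; refl; sym; trans; cong; cong₂; subst)
open import Function.Bundles using (_⇔_; mk⇔)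

open +-*-Solver using (solve; _:=_; _:+_; con)

m+0+1≡1+m : ∀ m → m + 0 + 1 ≡ suc m
m+0+1≡1+m = solve 1 (λ m → m :+ con 0 :+ con 1 := con 1 :+ m) refl

m+n+1≡1+m+n : ∀ m n → m + n + 1 ≡ suc (m + n)
m+n+1≡1+m+n = solve 2 (λ m n → m :+ n :+ con 1 := con 1 :+ m :+ n) refl

m+n+1+o≡m+[1+n+o] : ∀ m n o → m + n + 1 + o ≡ m + suc (n + o)
m+n+1+o≡m+[1+n+o] = solve 3 (λ m n o → m :+ n :+ con 1 :+ o := m :+ (con 1 :+ n :+ o)) refl

↭-head-extremal : ∀ {A : Set} {R : A → A → Set} →
  (∀ {a b} → R a b → R b a → a ≡ b) →
  ∀ {x y xs ys} → x ∷ xs ↭ ys → All (R x) xs → y ∈ ys → All (R y) ys → x ≡ y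
↭-head-extremal antisym p x≼xs y∈ys y≼ys with ∈-resp-↭ (↭-sym p) y∈ys
... | here refl = refl
... | there y∈xs = antisym (All.lookup x≼xs y∈xs) (All.lookup y≼ys (∈-resp-↭ p (here refl)))

interval : ℕ → ℕ → List ℕ
interval m zero = []
interval m (suc n) = suc m ∷ interval (suc m) n

applyUpTo≡interval : ∀ m n (f : ℕ → ℕ) → (∀ k → f k ≡ suc (m + k)) → applyUpTo f n ≡ interval m n
applyUpTo≡interval m zero f f≗ = refl
applyUpTo≡interval m (suc n) f f≗ =
  cong₂ _∷_ (trans (f≗ 0) (cong suc (+-identityʳ m)))
    (applyUpTo≡interval (suc m) n (λ k → f (suc k)) (λ k → trans (f≗ (suc k)) (cong suc (+-suc m k))))

[n]≡interval : ∀ n → [ n ] ≡ interval 0 n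
[n]≡interval n = trans (map-upTo suc n) (applyUpTo≡interval 0 n suc (λ _ → refl))

interval-∷ʳ : ∀ m n → interval m n ∷ʳ suc (m + n) ≡ interval m (suc n)
interval-∷ʳ m zero = cong (λ k → suc k ∷ []) (+-identityʳ m)
interval-∷ʳ m (suc n) = cong (suc m ∷_) (trans (cong (λ k → interval (suc m) n ∷ʳ suc k) (+-suc m n)) (interval-∷ʳ (suc m) n))

interval-↭-∷ : ∀ m n → interval m (suc n) ↭ suc (m + n) ∷ interval m n
interval-↭-∷ m n = ↭-trans (↭-reflexive (sym (interval-∷ʳ m n))) (↭-sym (∷↭∷ʳ _ (interval m n)))

interval-lower : ∀ m n → All (m <_) (interval m n)
interval-lower m zero = []
interval-lower m (suc n) = ≤-refl ∷ All.map (<-trans ≤-refl) (interval-lower (suc m) n)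

interval-upper : ∀ m n → All (_≤ m + n) (interval m n)
interval-upper m zero = []
interval-upper m (suc n) =
  subst (λ k → All (_≤ k) (interval m (suc n))) (sym (+-suc m n))
    (s≤s (m≤m+n m n) ∷ interval-upper (suc m) n)

preorderLabels-lower : ∀ m t → All (m <_) (preorderLabels m t)
preorderLabels-lower m leaf = []
preorderLabels-lower m (node l r) =
  m<root ∷ ++⁺ (preorderLabels-lower m l) (All.map (<-trans m<root) (preorderLabels-lower _ r))
  where
  m<root : m < m + internal l + 1
  m<root = subst (m <_) (sym (m+n+1≡1+m+n m (internal l))) (s≤s (m≤m+n m (internal l)))

preorderLabels-upper : ∀ m t → All (_≤ m + internal t) (preorderLabels m t)
preorderLabels-upper m leaf = []
preorderLabels-upper m (node l r) =
  root≤ ∷ ++⁺ (All.map (λ y≤ → ≤-trans y≤ left≤) (preorderLabels-upper m l))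
              (All.map (λ y≤ → ≤-trans y≤ (≤-reflexive right≡)) (preorderLabels-upper _ r))
  where
  right≡ : m + internal l + 1 + internal r ≡ m + internal (node l r)
  right≡ = m+n+1+o≡m+[1+n+o] m (internal l) (internal r)
  root≤ : m + internal l + 1 ≤ m + internal (node l r)
  root≤ = subst (m + internal l + 1 ≤_) right≡ (m≤m+n _ (internal r))
  left≤ : m + internal l ≤ m + internal (node l r)
  left≤ = +-monoʳ-≤ m (m≤n⇒m≤1+n (m≤m+n (internal l) (internal r)))

MinOrMax : ℕ → List ℕ → Set
MinOrMax x xs = All (x ≤_) xs ⊎ All (_≤ x) xs

minOrMaxSuffix-∷ : ∀ {x xs} → MinOrMax x xs → MinOrMaxSuffix xs → MinOrMaxSuffix (x ∷ xs)
minOrMaxSuffix-∷ x-ext xs-ext fzero = x-ext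
minOrMaxSuffix-∷ x-ext xs-ext (fsuc i) = xs-ext i

skew⇒minOrMaxSuffix : ∀ m t → Skew t → MinOrMaxSuffix (preorderLabels m t)
skew⇒minOrMaxSuffix m leaf _ ()
skew⇒minOrMaxSuffix m (node leaf r) (_ , _ , skew-r) =
  minOrMaxSuffix-∷ (inj₁ (All.map <⇒≤ (preorderLabels-lower _ r))) (skew⇒minOrMaxSuffix _ r skew-r)
skew⇒minOrMaxSuffix m (node l@(node _ _) leaf) (_ , skew-l , _) =
  subst (λ ys → MinOrMaxSuffix (m + internal l + 1 ∷ ys)) (sym (++-identityʳ (preorderLabels m l)))
    (minOrMaxSuffix-∷ (inj₂ (All.map (λ y≤ → ≤-trans y≤ (m≤m+n _ 1)) (preorderLabels-upper m l)))
      (skew⇒minOrMaxSuffix m l skew-l))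
skew⇒minOrMaxSuffix m (node (node _ _) (node _ _)) (inj₁ () , _)
skew⇒minOrMaxSuffix m (node (node _ _) (node _ _)) (inj₂ () , _)

minOrMaxSuffix⇒skew : ∀ m n σ → σ ↭ interval m n → MinOrMaxSuffix σ →
  Σ FBT (λ t → Skew t × internal t ≡ n × preorderLabels m t ≡ σ)
minOrMaxSuffix⇒skew m zero σ p _ with refl ← ↭-empty-inv p = leaf , tt , refl , refl
minOrMaxSuffix⇒skew m (suc n) [] p _ with () ← ¬x∷xs↭[] (↭-sym p)
minOrMaxSuffix⇒skew m (suc n) (x ∷ xs) p ext with ext fzero
... | inj₁ x≤xs
  with refl ← ↭-head-extremal ≤-antisym p x≤xs (here refl) (interval-lower m (suc n))
  with t , skew , refl , refl ← minOrMaxSuffix⇒skew (suc m) n xs (drop-∷ p) (λ i → ext (fsuc i))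
  = node leaf t , (inj₁ tt , tt , skew) , refl ,
    cong (λ k → k ∷ preorderLabels k t) (m+0+1≡1+m m)
... | inj₂ xs≤x
  with p′ ← ↭-trans p (interval-↭-∷ m n)
  with refl ← ↭-head-extremal (λ a≥b b≥a → ≤-antisym b≥a a≥b) p′ xs≤x (here refl)
                (≤-refl ∷ All.map m≤n⇒m≤1+n (interval-upper m n))
  with t , skew , refl , refl ← minOrMaxSuffix⇒skew m n xs (drop-∷ p′) (λ i → ext (fsuc i))
  = node t leaf , (inj₂ tt , skew , tt) , cong suc (+-identityʳ _) ,
    cong₂ _∷_ (m+n+1≡1+m+n m _) (++-identityʳ _)

lemma1 : (n : ℕ) (σ : List ℕ) → IsPermOf n σ →
    (IsSkewPerm n σ ⇔ MinOrMaxSuffix σ)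
lemma1 n σ σ↭[n] = mk⇔
  (λ { (t , skew , _ , refl) → skew⇒minOrMaxSuffix 0 t skew })
  (minOrMaxSuffix⇒skew 0 n σ (subst (σ ↭_) ([n]≡interval n) σ↭[n]))
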